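{- Let $G=(V,E)$ be a connected undirected (multi)graph and let $U\subseteq V$ be a 3-edge-connected component of $G$. Suppose that $\{(v,w),(\ddot{w},d)\}$ is a cut-pair of $G$ with $w,\ddot{w}\in U$ and $v,d\notin U$, and that these are the only edges of $G$ having exactly one end-vertex in $U$. If $w\neq\ddot{w}$, let $\acute{G}_{\langle U\rangle}$ be the graph consisting of the induced subgraph $G_{\langle U\rangle}$ together with one new edge $(w,\ddot{w})\notin E$; if $w=\ddot{w}$, let $\acute{G}_{\langle U\rangle}=G_{\langle U\rangle}$. Then $\acute{G}_{\langle U\rangle}$ is 3-edge-connected.
   Context: Graphs may have parallel edges. A bridge is an edge whose removal disconnects the graph. A cut-pair is a pair of edges, neither a bridge, whose removal disconnects the graph. A graph is 3-edge-connected if it is connected, has no bridge and no cut-pair. A 3-edge-connected component of $G$ is a maximal set $U\subseteq V$ such that every two distinct vertices of $U$ are joined by three edge-disjoint paths in $G$. $G_{\langle U\rangle}$ denotes the maximal subgraph of $G$ with vertex set $U$. -}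

module Defs where

open import Data.Nat using (ℕ)
open import Data.Fin using (Fin)
open import Data.Fin.Subset using (Subset; _∈_; _∉_; _⊆_)
open import Data.Product using (Σ; ∃; ∃-syntax; _×_; _,_; proj₁; proj₂)
open import Data.Sum using (_⊎_; inj₁; inj₂)
open import Data.Unit using (⊤; tt)
open import Data.Empty using (⊥)
open import Data.List using (List; []; _∷_)
open import Data.List.Relation.Unary.All using (All)
import Data.List.Membership.Propositional as LM
open import Relation.Nullary using (¬_)
open import Relation.Binary.PropositionalEquality using (_≡_; _≢_)

-- A multigraph: a vertex type, an edge type, and the two end-vertices of
-- each edge (undirected; the order of the pair is irrelevant, see Joins).
-- Distinct edges may have the same ends (parallel edges).
record Graph : Set₁ where
  constructor graph
  field
    V    : Set
    E    : Set
    ends : E → V × V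
open Graph public

Joins : (G : Graph) → E G → V G → V G → Set
Joins G e x y = (ends G e ≡ (x , y)) ⊎ (ends G e ≡ (y , x))

data Walk (G : Graph) : V G → V G → Set where
  []   : ∀ {u} → Walk G u u
  step : ∀ {u x v} (e : E G) → Joins G e u x → Walk G x v → Walk G u v

edgesOf : ∀ {G u v} → Walk G u v → List (E G)
edgesOf []             = []
edgesOf (step e _ p)   = e ∷ edgesOf p

Reach : (G : Graph) → (E G → Set) → V G → V G → Set
Reach G X u v = Σ (Walk G u v) λ p → All (λ e → ¬ X e) (edgesOf p)

Disconnects : (G : Graph) → (E G → Set) → Set
Disconnects G X = ∃[ u ] ∃[ v ] ¬ Reach G X u v

Connected : Graph → Set
Connected G = ∀ u v → Reach G (λ _ → ⊥) u v

IsBridge : (G : Graph) → E G → Set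
IsBridge G e = Disconnects G (λ f → f ≡ e)

IsCutPair : (G : Graph) → E G → E G → Set
IsCutPair G e f =
  (e ≢ f) × ¬ IsBridge G e × ¬ IsBridge G f
  × Disconnects G (λ g → (g ≡ e) ⊎ (g ≡ f))

ThreeEdgeConnected : Graph → Set
ThreeEdgeConnected G =
  Connected G × (∀ e → ¬ IsBridge G e) × (∀ e f → ¬ IsCutPair G e f)

EdgeDisjoint : ∀ {G u v} → Walk G u v → Walk G u v → Set
EdgeDisjoint p q = ∀ e → e LM.∈ edgesOf p → e LM.∈ edgesOf q → ⊥

-- three pairwise edge-disjoint u–v paths (walks; any walk contains a path
-- using a subset of its edges, so this is the same as paths)
ThreeEdgeDisjointPaths : (G : Graph) → V G → V G → Set
ThreeEdgeDisjointPaths G u v =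
  Σ (Walk G u v) λ p → Σ (Walk G u v) λ q → Σ (Walk G u v) λ r →
    EdgeDisjoint p q × EdgeDisjoint p r × EdgeDisjoint q r

FinGraph : (n m : ℕ) → (Fin m → Fin n × Fin n) → Graph
FinGraph n m ends = graph (Fin n) (Fin m) ends

Pairwise3 : ∀ {n m} (ends : Fin m → Fin n × Fin n) → Subset n → Set
Pairwise3 {n} {m} ends U =
  ∀ u v → u ∈ U → v ∈ U → u ≢ v → ThreeEdgeDisjointPaths (FinGraph n m ends) u v

Is3ECComponent : ∀ {n m} (ends : Fin m → Fin n × Fin n) → Subset n → Set
Is3ECComponent {n} ends U =
  Pairwise3 ends U × (∀ (U' : Subset n) → U ⊆ U' → Pairwise3 ends U' → U' ⊆ U)

Induced : ∀ {n m} (ends : Fin m → Fin n × Fin n) → Subset n → Graph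
Induced {n} {m} ends U =
  graph (Σ (Fin n) (_∈ U))
        (Σ (Fin m) λ e → (proj₁ (ends e) ∈ U) × (proj₂ (ends e) ∈ U))
        (λ { (e , p , q) → ((proj₁ (ends e) , p) , (proj₂ (ends e) , q)) })

AddEdge : (H : Graph) → V H → V H → Graph
AddEdge H x y =
  graph (V H) (E H ⊎ ⊤) λ { (inj₁ e) → ends H e ; (inj₂ _) → (x , y) }

CrossesU : ∀ {n m} (ends : Fin m → Fin n × Fin n) → Subset n → Fin m → Set
CrossesU ends U e =
  (proj₁ (ends e) ∈ U × proj₂ (ends e) ∉ U) ⊎ (proj₁ (ends e) ∉ U × proj₂ (ends e) ∈ U)

module Submission where

-- Between any two vertices of U there are three edge-disjoint walks in G. Each of them
-- projects to a walk inside U: its edges within U are kept, and each excursion outside U,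
-- which can only leave and re-enter U through e₁ and e₂, is replaced by the new edge w–ẅ,
-- or dropped if it returns to where it left. Every projected edge is charged to an edge of
-- the original walk, so the projections are again edge-disjoint, and three edge-disjoint
-- walks between any two vertices leave no bridge and no cut-pair. When w ≡ ẅ the new edge
-- is a loop and can be deleted.

open import Defs
open import Data.Nat using (ℕ)
open import Data.Fin using (Fin; _≟_)
open import Data.Fin.Subset using (Subset; _∈_; _∉_)
open import Data.Fin.Subset.Properties using (_∈?_)
open import Data.Product using (Σ; _×_; _,_; proj₁; proj₂)
import Data.Product.Properties as Product
open import Data.Sum using (_⊎_; inj₁; inj₂)
import Data.Sum as Sum
import Data.Sum.Properties as Sum
open import Data.Unit using (tt)
import Data.Unit.Properties as Unit
open import Data.Empty using (⊥-elim)
open import Data.List using (List; []; _∷_)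
open import Data.List.Relation.Unary.All as All using (All; []; _∷_)
open import Data.List.Relation.Unary.Any using (here; there)
open import Data.List.Membership.Propositional using () renaming (_∈_ to _∈ₗ_; _∉_ to _∉ₗ_)
import Data.List.Membership.DecPropositional as DecMembership
open import Data.List.Relation.Binary.Subset.Propositional.Properties using (xs⊆x∷xs; ∷⁺ʳ)
open import Data.Vec.Base using (here; there)
open import Function using (_∘_; id)
open import Relation.Nullary using (yes; no)
open import Relation.Binary.Definitions using (DecidableEquality)
open import Relation.Binary.PropositionalEquality using (_≡_; _≢_; refl; cong; cong₂)

module _ {G : Graph} where

  _++ʷ_ : ∀ {x y z} → Walk G x y → Walk G y z → Walk G x z
  []         ++ʷ q = q
  step e j p ++ʷ q = step e j (p ++ʷ q)

  All-++ʷ : ∀ {P : E G → Set} {x y z} (p : Walk G x y) (q : Walk G y z) →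
            All P (edgesOf p) → All P (edgesOf q) → All P (edgesOf (p ++ʷ q))
  All-++ʷ []           q []         Pq = Pq
  All-++ʷ (step e j p) q (Pe ∷ Pp) Pq = Pe ∷ All-++ʷ p q Pp Pq

  Reach-mono : ∀ {X Y : E G → Set} {x y} → (∀ {e} → X e → Y e) → Reach G Y x y → Reach G X x y
  Reach-mono X⇒Y (p , p-avoids) = p , All.map (_∘ X⇒Y) p-avoids

module ThreeDisjointPaths
  {H : Graph} (_≟ᴱ_ : DecidableEquality (E H)) (_≟ⱽ_ : DecidableEquality (V H))
  (paths : ∀ x y → x ≢ y → ThreeEdgeDisjointPaths H x y) where

  open DecMembership _≟ᴱ_ using () renaming (_∈?_ to _∈ₗ?_)

  avoiding : ∀ {x y e f} (p : Walk H x y) → e ∉ₗ edgesOf p → f ∉ₗ edgesOf p →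
             Reach H (λ g → g ≡ e ⊎ g ≡ f) x y
  avoiding p e∉p f∉p = p , All.tabulate λ { g∈p (inj₁ refl) → e∉p g∈p ; g∈p (inj₂ refl) → f∉p g∈p }

  one-of-two-avoiding : ∀ {x y e f} (q r : Walk H x y) → EdgeDisjoint q r →
                        e ∉ₗ edgesOf q → e ∉ₗ edgesOf r → Reach H (λ g → g ≡ e ⊎ g ≡ f) x y
  one-of-two-avoiding {f = f} q r q#r e∉q e∉r with f ∈ₗ? edgesOf q
  ... | no  f∉q = avoiding q e∉q f∉q
  ... | yes f∈q = avoiding r e∉r (q#r f f∈q)

  -- Each edge lies on at most one of three edge-disjoint walks, so two edges miss one of them.
  one-of-three-avoiding : ∀ {x y} → ThreeEdgeDisjointPaths H x y → ∀ e f →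
                          Reach H (λ g → g ≡ e ⊎ g ≡ f) x y
  one-of-three-avoiding (p , q , r , p#q , p#r , q#r) e f with e ∈ₗ? edgesOf p | f ∈ₗ? edgesOf p
  ... | yes e∈p | _       = one-of-two-avoiding q r q#r (p#q e e∈p) (p#r e e∈p)
  ... | no  _   | yes f∈p =
    Reach-mono Sum.swap (one-of-two-avoiding q r q#r (p#q f f∈p) (p#r f f∈p))
  ... | no  e∉p | no  f∉p = avoiding p e∉p f∉p

  reach-avoiding-two : ∀ x y e f → Reach H (λ g → g ≡ e ⊎ g ≡ f) x y
  reach-avoiding-two x y e f with x ≟ⱽ y
  ... | yes refl = [] , []
  ... | no  x≢y  = one-of-three-avoiding (paths x y x≢y) e f

  connected : Connected H
  connected x y with x ≟ⱽ y
  ... | yes refl = [] , []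
  ... | no  x≢y  = proj₁ (paths x y x≢y) , All.tabulate λ _ ()

  threeEdgeConnected : ThreeEdgeConnected H
  threeEdgeConnected =
    connected ,
    (λ e (x , y , ¬reach) → ¬reach (Reach-mono inj₁ (reach-avoiding-two x y e e))) ,
    (λ e f (_ , _ , _ , x , y , ¬reach) → ¬reach (reach-avoiding-two x y e f))

WalkTransfer : (H H' : Graph) → (V H' → V H) → (E H' → E H) → Set
WalkTransfer H H' ι f =
  ∀ {a b} (p : Walk H (ι a) (ι b)) → Σ (Walk H' a b) λ q → All (λ h → f h ∈ₗ edgesOf p) (edgesOf q)

module _ {H H' : Graph} {ι : V H' → V H} {f : E H' → E H} where

  transfer-∘ : ∀ {H''} {κ : V H'' → V H'} {g : E H'' → E H'} →
               WalkTransfer H H' ι f → WalkTransfer H' H'' κ g → WalkTransfer H H'' (ι ∘ κ) (f ∘ g)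
  transfer-∘ T T' p =
    let (q , q⊑p) = T p
        (r , r⊑q) = T' q
    in r , All.map (All.lookup q⊑p) r⊑q

  transfer-paths : WalkTransfer H H' ι f → ∀ {a b} →
                   ThreeEdgeDisjointPaths H (ι a) (ι b) → ThreeEdgeDisjointPaths H' a b
  transfer-paths T (p , q , r , p#q , p#r , q#r) =
    let (p' , p'⊑p) = T p
        (q' , q'⊑q) = T q
        (r' , r'⊑r) = T r
    in p' , q' , r' , disjoint p#q p'⊑p q'⊑q , disjoint p#r p'⊑p r'⊑r , disjoint q#r q'⊑q r'⊑r
    where
    disjoint : ∀ {x y a b} {s t : Walk H x y} {s' t' : Walk H' a b} → EdgeDisjoint s t →
               All (λ h → f h ∈ₗ edgesOf s) (edgesOf s') →
               All (λ h → f h ∈ₗ edgesOf t) (edgesOf t') → EdgeDisjoint s' t'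
    disjoint s#t s'⊑s t'⊑t h h∈s' h∈t' = s#t (f h) (All.lookup s'⊑s h∈s') (All.lookup t'⊑t h∈t')

drop-loop : ∀ {H : Graph} {x y : V H} → x ≡ y → WalkTransfer (AddEdge H x y) H id inj₁
drop-loop refl [] = [] , []
drop-loop refl (step (inj₁ e) j p) =
  let (q , q⊑p) = drop-loop refl p in step e j q , here refl ∷ All.map there q⊑p
drop-loop refl (step (inj₂ tt) (inj₁ refl) p) =
  let (q , q⊑p) = drop-loop refl p in q , All.map there q⊑p
drop-loop refl (step (inj₂ tt) (inj₂ refl) p) =
  let (q , q⊑p) = drop-loop refl p in q , All.map there q⊑p

∈-irrelevant : ∀ {n} {x : Fin n} {S : Subset n} (p q : x ∈ S) → p ≡ q
∈-irrelevant here      here      = refl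
∈-irrelevant (there p) (there q) = cong there (∈-irrelevant p q)

module _ {n : ℕ} {S : Subset n} where

  ≡-in : ∀ {a b} → a ≡ b → (aS : a ∈ S) (bS : b ∈ S) →
         _≡_ {A = Σ (Fin n) (_∈ S)} (a , aS) (b , bS)
  ≡-in refl aS bS = cong (_ ,_) (∈-irrelevant aS bS)

  _≟ˢ_ : DecidableEquality (Σ (Fin n) (_∈ S))
  _≟ˢ_ = Product.≡-dec _≟_ λ p q → yes (∈-irrelevant p q)

induced-edge-≟ : ∀ {n m} (ends : Fin m → Fin n × Fin n) (U : Subset n) →
                 DecidableEquality (E (Induced ends U))
induced-edge-≟ _ _ =
  Product.≡-dec _≟_ λ (p , q) (p' , q') → yes (cong₂ _,_ (∈-irrelevant p p') (∈-irrelevant q q'))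

module ShortcutExcursions {n m : ℕ} (ends : Fin m → Fin n × Fin n) (U : Subset n)
  (e₁ e₂ : Fin m) {v w ẅ d : Fin n}
  (e₁-joins : Joins (FinGraph n m ends) e₁ v w) (e₂-joins : Joins (FinGraph n m ends) e₂ ẅ d)
  (wU : w ∈ U) (ẅU : ẅ ∈ U) (v∉U : v ∉ U) (d∉U : d ∉ U)
  (only-crossing : ∀ e → CrossesU ends U e → (e ≡ e₁) ⊎ (e ≡ e₂)) where

  G Ĝ : Graph
  G = FinGraph n m ends
  Ĝ = AddEdge (Induced ends U) (w , wU) (ẅ , ẅU)

  -- An excursion of a walk outside U leaves and re-enters U through e₁ and e₂, one each
  -- whenever it is shortcut by the new edge, so the new edge can be charged to e₁.
  charge : E Ĝ → Fin m
  charge (inj₁ (e , _)) = e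
  charge (inj₂ tt)      = e₁

  ChargedTo : List (Fin m) → ∀ {a b} → Walk Ĝ a b → Set
  ChargedTo L q = All (λ h → charge h ∈ₗ L) (edgesOf q)

  AttachesAt : Fin m → Fin n → Set
  AttachesAt e a = (e ≡ e₁ × a ≡ w) ⊎ (e ≡ e₂ × a ≡ ẅ)

  crosses : ∀ {e x a} → Joins G e x a → a ∈ U → x ∉ U → CrossesU ends U e
  crosses (inj₁ eq) aU x∉U rewrite eq = inj₂ (x∉U , aU)
  crosses (inj₂ eq) aU x∉U rewrite eq = inj₁ (aU , x∉U)

  inner-end-unique : ∀ {e x a y b} → Joins G e x a → Joins G e y b → a ∈ U → y ∉ U → a ≡ b
  inner-end-unique (inj₁ eq) (inj₁ eq') _  _   rewrite eq with refl ← eq' = refl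
  inner-end-unique (inj₁ eq) (inj₂ eq') aU y∉U rewrite eq with refl ← eq' = ⊥-elim (y∉U aU)
  inner-end-unique (inj₂ eq) (inj₁ eq') aU y∉U rewrite eq with refl ← eq' = ⊥-elim (y∉U aU)
  inner-end-unique (inj₂ eq) (inj₂ eq') _  _   rewrite eq with refl ← eq' = refl

  crossing-attaches : ∀ {e x a} → Joins G e x a → a ∈ U → x ∉ U → AttachesAt e a
  crossing-attaches j aU x∉U with only-crossing _ (crosses j aU x∉U)
  ... | inj₁ refl = inj₁ (refl , inner-end-unique j e₁-joins aU v∉U)
  ... | inj₂ refl = inj₂ (refl , inner-end-unique j (Sum.swap e₂-joins) aU d∉U)

  induced-edge : ∀ {e a b} (aU : a ∈ U) (bU : b ∈ U) → Joins G e a b →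
                 Σ (proj₁ (ends e) ∈ U × proj₂ (ends e) ∈ U) λ eU →
                   Joins Ĝ (inj₁ (e , eU)) (a , aU) (b , bU)
  induced-edge aU bU (inj₁ eq) rewrite eq = (aU , bU) , inj₁ refl
  induced-edge aU bU (inj₂ eq) rewrite eq = (bU , aU) , inj₂ refl

  empty-walk : ∀ {a} {P : E Ĝ → Set} (aU aU' : a ∈ U) →
               Σ (Walk Ĝ (a , aU) (a , aU')) (All P ∘ edgesOf)
  empty-walk aU aU' rewrite ∈-irrelevant aU aU' = [] , []

  shortcut : ∀ {ea a eb b} (aU : a ∈ U) (bU : b ∈ U) → AttachesAt ea a → AttachesAt eb b →
             ∀ L → Σ (Walk Ĝ (a , aU) (b , bU)) (ChargedTo (ea ∷ eb ∷ L))
  shortcut {a = a} {b = b} aU bU _ _ _ with a ≟ b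
  ... | yes refl = empty-walk aU bU
  shortcut aU bU (inj₁ (refl , refl)) (inj₂ (refl , refl)) _ | no _ =
    step (inj₂ tt) (inj₁ (cong₂ _,_ (≡-in refl wU aU) (≡-in refl ẅU bU))) [] ,
    here refl ∷ []
  shortcut aU bU (inj₂ (refl , refl)) (inj₁ (refl , refl)) _ | no _ =
    step (inj₂ tt) (inj₂ (cong₂ _,_ (≡-in refl wU bU) (≡-in refl ẅU aU))) [] ,
    there (here refl) ∷ []
  shortcut _ _ (inj₁ (refl , refl)) (inj₁ (refl , refl)) _ | no w≢w = ⊥-elim (w≢w refl)
  shortcut _ _ (inj₂ (refl , refl)) (inj₂ (refl , refl)) _ | no ẅ≢ẅ = ⊥-elim (ẅ≢ẅ refl)

  mutual
    project : ∀ {a b} (aU : a ∈ U) (bU : b ∈ U) (p : Walk G a b) →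
              Σ (Walk Ĝ (a , aU) (b , bU)) (ChargedTo (edgesOf p))
    project aU bU [] = empty-walk aU bU
    project aU bU (step {x = x} e j p) with x ∈? U
    ... | yes xU =
      let (eU , ĵ) = induced-edge aU xU j
          (q , q⊑p) = project xU bU p
      in step (inj₁ (e , eU)) ĵ q , here refl ∷ All.map there q⊑p
    ... | no x∉U = project-excursion aU (crossing-attaches (Sum.swap j) aU x∉U) x∉U bU p

    project-excursion : ∀ {ea a x b} (aU : a ∈ U) → AttachesAt ea a → x ∉ U →
                        (bU : b ∈ U) (p : Walk G x b) →
                        Σ (Walk Ĝ (a , aU) (b , bU)) (ChargedTo (ea ∷ edgesOf p))
    project-excursion aU a-att x∉U bU [] = ⊥-elim (x∉U bU)
    project-excursion {ea} aU a-att x∉U bU (step {x = y} e j p) with y ∈? U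
    ... | no y∉U =
      let (q , q⊑p) = project-excursion aU a-att y∉U bU p
      in q , All.map (∷⁺ʳ ea (xs⊆x∷xs _ e)) q⊑p
    ... | yes yU =
      let (s , s⊑) = shortcut aU yU a-att (crossing-attaches j yU x∉U) (edgesOf p)
          (q , q⊑p) = project yU bU p
      in s ++ʷ q , All-++ʷ s q s⊑ (All.map (λ i → there (there i)) q⊑p)

  project-transfer : WalkTransfer G Ĝ proj₁ charge
  project-transfer {a , aU} {b , bU} = project aU bU

lemma3 : (n m : ℕ) (ends : Fin m → Fin n × Fin n) (U : Subset n)
    (v w ẅ d : Fin n) (e₁ e₂ : Fin m) →
    Connected (FinGraph n m ends) →
    Is3ECComponent ends U →
    IsCutPair (FinGraph n m ends) e₁ e₂ →
    Joins (FinGraph n m ends) e₁ v w →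
    Joins (FinGraph n m ends) e₂ ẅ d →
    (wU : w ∈ U) → (ẅU : ẅ ∈ U) → v ∉ U → d ∉ U →
    (∀ e → CrossesU ends U e → (e ≡ e₁) ⊎ (e ≡ e₂)) →
    (w ≢ ẅ → ThreeEdgeConnected (AddEdge (Induced ends U) (w , wU) (ẅ , ẅU)))
    × (w ≡ ẅ → ThreeEdgeConnected (Induced ends U))
lemma3 n m ends U v w ẅ d e₁ e₂ _ (pairwise3 , _) _ e₁-joins e₂-joins wU ẅU v∉U d∉U only-crossing =
  (λ _ → threeEdgeConnected (Sum.≡-dec (induced-edge-≟ ends U) Unit._≟_) _≟ˢ_ λ a b a≢b →
           transfer-paths project-transfer (paths-in-G a b a≢b)) ,
  (λ w≡ẅ → threeEdgeConnected (induced-edge-≟ ends U) _≟ˢ_ λ a b a≢b →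
             transfer-paths (transfer-∘ project-transfer (drop-loop (≡-in w≡ẅ wU ẅU)))
                            (paths-in-G a b a≢b))
  where
  open ThreeDisjointPaths using (threeEdgeConnected)
  open ShortcutExcursions ends U e₁ e₂ e₁-joins e₂-joins wU ẅU v∉U d∉U only-crossing

  paths-in-G : (a b : V (Induced ends U)) → a ≢ b → ThreeEdgeDisjointPaths G (proj₁ a) (proj₁ b)
  paths-in-G (a , aU) (b , bU) a≢b = pairwise3 a b aU bU λ a≡b → a≢b (≡-in a≡b aU bU)
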